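{- Let $n\ge1$ and let $\Theta=(\alpha,\beta,\gamma)\in S_n^3$ where $\alpha,\beta,\gamma$ are all $n$-cycles. Then the number of partial Latin squares of order $n$ and size $n$ having $\Theta$ as an autotopism is $n^2$. Moreover, if $n>2$, the number of partial Latin squares of order $n$ and size $2n$ having $\Theta$ as an autotopism is $\dfrac{n^2(n-1)(n-2)}{2}$.
   Context: A partial Latin square of order $n$ is an $n\times n$ array whose cells are empty or contain a symbol of $[n]$, each symbol at most once per row and column; its size is the number of filled cells and $O(P)$ is its set of (row, column, symbol) triples of filled cells. $\Theta=(\alpha,\beta,\gamma)$ is an autotopism of $P$ if $\{(\alpha(r),\beta(c),\gamma(s)):(r,c,s)\in O(P)\}=O(P)$. -}

module Defs where

open import Data.Nat using (ℕ; zero; suc; _+_)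
open import Data.Fin using (Fin)
open import Data.Fin.Permutation using (Permutation′; _⟨$⟩ʳ_)
open import Data.Maybe using (Maybe; just; nothing)
open import Data.Vec using (Vec; lookup)
open import Data.Product using (Σ; ∃; _×_; _,_)
open import Data.Irrelevant using (Irrelevant)
open import Relation.Binary.PropositionalEquality using (_≡_)

Array : ℕ → Set
Array n = Vec (Vec (Maybe (Fin n)) n) n

entry : ∀ {n} → Array n → Fin n → Fin n → Maybe (Fin n)
entry P r c = lookup (lookup P r) c

_∈O_ : ∀ {n} → Fin n × Fin n × Fin n → Array n → Set
(r , c , s) ∈O P = entry P r c ≡ just s

IsPLS : ∀ {n} → Array n → Set
IsPLS {n} P =
  (∀ (r c c' s : Fin n) → (r , c , s) ∈O P → (r , c' , s) ∈O P → c ≡ c') ×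
  (∀ (r r' c s : Fin n) → (r , c , s) ∈O P → (r' , c , s) ∈O P → r ≡ r')

rowSize : ∀ {m n} → Vec (Maybe (Fin n)) m → ℕ
rowSize Vec.[] = 0
rowSize (just _ Vec.∷ xs) = suc (rowSize xs)
rowSize (nothing Vec.∷ xs) = rowSize xs

sizeRows : ∀ {m n} → Vec (Vec (Maybe (Fin n)) n) m → ℕ
sizeRows Vec.[] = 0
sizeRows (row Vec.∷ rows) = rowSize row + sizeRows rows

size : ∀ {n} → Array n → ℕ
size P = sizeRows P

iter : ∀ {n} → Permutation′ n → ℕ → Fin n → Fin n
iter σ zero i = i
iter σ (suc k) i = σ ⟨$⟩ʳ iter σ k i

IsNCycle : ∀ {n} → Permutation′ n → Set
IsNCycle {n} σ = ∀ (i j : Fin n) → ∃ λ k → iter σ k i ≡ j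

IsAutotopism : ∀ {n} → Permutation′ n × Permutation′ n × Permutation′ n → Array n → Set
IsAutotopism {n} (α , β , γ) P =
  (∀ (r c s : Fin n) → (r , c , s) ∈O P →
     (α ⟨$⟩ʳ r , β ⟨$⟩ʳ c , γ ⟨$⟩ʳ s) ∈O P) ×
  (∀ (r' c' s' : Fin n) → (r' , c' , s') ∈O P →
     Σ (Fin n) λ r → Σ (Fin n) λ c → Σ (Fin n) λ s →
       (r , c , s) ∈O P × α ⟨$⟩ʳ r ≡ r' × β ⟨$⟩ʳ c ≡ c' × γ ⟨$⟩ʳ s ≡ s')

-- The property is wrapped in Irrelevant so that two elements are
-- equal iff their arrays are equal; hence a bijection with Fin k means
-- "there are exactly k such partial Latin squares".
PLSWithAutotopism : (n m : ℕ) → Permutation′ n × Permutation′ n × Permutation′ n → Set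
PLSWithAutotopism n m Θ =
  Σ (Array n) λ P → Irrelevant (IsPLS P × size P ≡ m × IsAutotopism Θ P)

module Submission where

open import Defs
open import Data.Empty using (⊥; ⊥-elim)
open import Data.Fin using (Fin; zero; suc; toℕ; fromℕ<; punchIn; punchOut) renaming (_<_ to _<ᶠ_)
open import Data.Fin.Permutation using (Permutation′; _⟨$⟩ʳ_; _⟨$⟩ˡ_; inverseˡ; inverseʳ; id; _∘ₚ_; flip)
open import Data.Fin.Properties
  using (_≟_; pigeonhole; toℕ-fromℕ<; toℕ<n; +↔⊎; *↔×; <⇒≢; punchInᵢ≢i; punchOut-cong; punchOut-punchIn;
         punchIn-punchOut; punchOut-injective)
open import Data.Irrelevant using (Irrelevant; [_])
import Data.Irrelevant as Irr
open import Data.Maybe using (Maybe; just; nothing)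
import Data.Maybe as Maybe
open import Data.Maybe.Properties using (just-injective; map-id; map-∘; map-cong; map-just)
import Data.Maybe.Properties as Maybeₚ
open import Data.Nat using (ℕ; zero; suc; _+_; _*_; _∸_; _^_; _≤_; _<_; _≥_; _>_; z<s; s<s; s≤s⁻¹; s<s⁻¹; NonZero)
import Data.Nat as ℕ
open import Data.Nat.Combinatorics using (_C_; nC1≡n; nCk+nC[k+1]≡[n+1]C[k+1])
open import Data.Nat.Divisibility using (_∣_; divides; m%n≡0⇒n∣m)
open import Data.Nat.DivMod using (_%_; _/_; m≡m%n+[m/n]*n; m%n<n; m*n/n≡m)
open import Data.Nat.Properties
  using (+-0-commutativeMonoid; +-comm; *-comm; *-identityʳ; *-distribʳ-+; *-cancelˡ-≡; suc-injective;
         ≤-refl; ≤-trans; ≤-total; <⇒≤; <-irrefl; m∸n+n≡m; m∸n≤m; m<n⇒0<n∸m; m≤n⇒m<n∨m≡n)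
open import Data.Nat.Tactic.RingSolver using (solve-∀)
open import Algebra.Properties.CommutativeMonoid.Sum +-0-commutativeMonoid using (sum; sum-cong-≗; ∑-permute)
open import Data.Product using (Σ; ∃; ∃₂; _×_; _,_; proj₁; proj₂; uncurry)
open import Data.Product.Function.NonDependent.Propositional using (_×-↔_)
open import Data.Sum using (_⊎_; inj₁; inj₂)
open import Data.Sum.Function.Propositional using (_⊎-↔_)
open import Data.Vec using (Vec; []; _∷_; lookup; replicate; tabulate; _[_]≔_)
open import Data.Vec.Properties
  using (lookup-replicate; lookup∘update; lookup∘update′; lookup∘tabulate; tabulate∘lookup; tabulate-cong)
import Data.Vec.Properties as Vecₚ
open import Function using (_∘_)
open import Function.Bundles using (_↔_; mk↔ₛ′; Inverse)
open import Function.Properties.Inverse using (↔-refl; ↔-sym; ↔-trans)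
open import Relation.Binary.Definitions using (DecidableEquality)
open import Relation.Binary.PropositionalEquality
open import Relation.Nullary using (yes; no)
open import Relation.Nullary.Decidable using (recompute)
open import Relation.Nullary.Recomputable using (¬-recompute)

-- Since α is an n-cycle every row is αᵏ r₀ for a fixed row r₀, and Θ is an autotopism
-- of P exactly when P (α r) (β c) = γ (P r c).  Such a P is therefore determined by its
-- first row g through P (αᵏ r₀) (βᵏ c) = γᵏ (g c), and every g arises: this is well defined
-- because in an n-cycle σᵃ x = σᵇ x depends only on a mod n.  Each row of P is a
-- relabelling of g, so |P| = n |g|, and being a partial Latin square is a condition on g
-- alone.  When g has one filled cell it always holds, giving n · n squares.  When g has
-- filled cells (a, x) and (b, y) with a < b, let βᵈ b = a; then P is a partial Latin square
-- iff x ≠ y and x ≠ γᵈ y, which exclude two distinct values of x, giving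
-- C(n,2) · n · (n − 2) squares.

-- Iterating a permutation

⟨$⟩ʳ-injective : ∀ {n} (π : Permutation′ n) {x y} → π ⟨$⟩ʳ x ≡ π ⟨$⟩ʳ y → x ≡ y
⟨$⟩ʳ-injective π {x} {y} e = trans (sym (inverseˡ π)) (trans (cong (π ⟨$⟩ˡ_) e) (inverseˡ π))

module _ {n : ℕ} (σ : Permutation′ n) where

  power : ℕ → Permutation′ n
  power zero    = id
  power (suc k) = power k ∘ₚ σ

  power-iter : ∀ k x → power k ⟨$⟩ʳ x ≡ iter σ k x
  power-iter zero    x = refl
  power-iter (suc k) x = cong (σ ⟨$⟩ʳ_) (power-iter k x)

  iter-+ : ∀ a b x → iter σ (a + b) x ≡ iter σ a (iter σ b x)
  iter-+ zero    b x = refl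
  iter-+ (suc a) b x = cong (σ ⟨$⟩ʳ_) (iter-+ a b x)

  iter-comm : ∀ a b x → iter σ a (iter σ b x) ≡ iter σ b (iter σ a x)
  iter-comm a b x = trans (sym (iter-+ a b x))
    (trans (cong (λ t → iter σ t x) (+-comm a b)) (iter-+ b a x))

  power⁻¹-iter : ∀ k x → power k ⟨$⟩ˡ iter σ k x ≡ x
  power⁻¹-iter k x = trans (cong (power k ⟨$⟩ˡ_) (sym (power-iter k x))) (inverseˡ (power k))

  iter-power⁻¹ : ∀ k x → iter σ k (power k ⟨$⟩ˡ x) ≡ x
  iter-power⁻¹ k x = trans (sym (power-iter k _)) (inverseʳ (power k))

  iter-injective : ∀ k {x y} → iter σ k x ≡ iter σ k y → x ≡ y
  iter-injective k {x} {y} e =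
    trans (sym (power⁻¹-iter k x)) (trans (cong (power k ⟨$⟩ˡ_) e) (power⁻¹-iter k y))

  iter-∸ : ∀ {p q} x → p ≤ q → iter σ q x ≡ iter σ (q ∸ p) (iter σ p x)
  iter-∸ {p} {q} x p≤q =
    trans (cong (λ t → iter σ t x) (sym (m∸n+n≡m p≤q))) (iter-+ (q ∸ p) p x)

  iter-* : ∀ {k x} → iter σ k x ≡ x → ∀ q → iter σ (q * k) x ≡ x
  iter-* e zero    = refl
  iter-* {k} {x} e (suc q) = trans (iter-+ k (q * k) x) (trans (cong (iter σ k) (iter-* e q)) e)

  iter-% : ∀ {k x} .{{_ : NonZero k}} → iter σ k x ≡ x → ∀ t → iter σ t x ≡ iter σ (t % k) x
  iter-% {k} {x} e t = trans (cong (λ u → iter σ u x) (m≡m%n+[m/n]*n t k))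
    (trans (iter-+ (t % k) ((t / k) * k) x) (cong (iter σ (t % k)) (iter-* e (t / k))))

-- n-cycles

module _ {n : ℕ} {σ : Permutation′ n} (σ-cycle : IsNCycle σ) where

  -- Every point is σ^(t mod k) x, so y ↦ t mod k would inject Fin n into Fin k.
  no-shorter-period : ∀ {k} x → 0 < k → k < n → iter σ k x ≢ x
  no-shorter-period {suc k-1} x _ k<n e = collision (pigeonhole k<n g)
    where
    open ≡-Reasoning
    k = suc k-1
    log : Fin n → ℕ
    log y = proj₁ (σ-cycle x y)
    g : Fin n → Fin k
    g y = fromℕ< (m%n<n (log y) k)
    iter-g : ∀ y → iter σ (toℕ (g y)) x ≡ y
    iter-g y = trans (cong (λ u → iter σ u x) (toℕ-fromℕ< (m%n<n (log y) k)))
      (trans (sym (iter-% σ e (log y))) (proj₂ (σ-cycle x y)))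
    collision : ∃₂ (λ i j → i <ᶠ j × g i ≡ g j) → ⊥
    collision (i , j , i<j , gi≡gj) = <-irrefl (cong toℕ (begin
      i                           ≡⟨ iter-g i ⟨
      iter σ (toℕ (g i)) x        ≡⟨ cong (λ u → iter σ (toℕ u) x) gi≡gj ⟩
      iter σ (toℕ (g j)) x        ≡⟨ iter-g j ⟩
      j                           ∎)) i<j

  -- Among x, σ x, …, σⁿ x two points coincide, so z = σⁱ x returns after some 0 < d ≤ n steps.
  period : ∀ x → iter σ n x ≡ x
  period x = collision (pigeonhole ≤-refl (λ (i : Fin (suc n)) → iter σ (toℕ i) x))
    where
    collision : ∃₂ (λ i j → i <ᶠ j × iter σ (toℕ i) x ≡ iter σ (toℕ j) x) → iter σ n x ≡ x
    collision (i , j , i<j , xi≡xj) =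
      iter-injective σ (toℕ i) (trans (iter-comm σ (toℕ i) n x) (subst (λ t → iter σ t z ≡ z) d≡n return))
      where
      d = toℕ j ∸ toℕ i
      z = iter σ (toℕ i) x
      return : iter σ d z ≡ z
      return = trans (sym (iter-∸ σ x (<⇒≤ i<j))) (sym xi≡xj)
      d≡n : d ≡ n
      d≡n with m≤n⇒m<n∨m≡n (≤-trans (m∸n≤m (toℕ j) (toℕ i)) (s≤s⁻¹ (toℕ<n j)))
      ... | inj₁ d<n = ⊥-elim (no-shorter-period z (m<n⇒0<n∸m i<j) d<n return)
      ... | inj₂ d≡n = d≡n

  iter-fixed⇒∣ : .{{_ : NonZero n}} → ∀ {k} x → iter σ k x ≡ x → n ∣ k
  iter-fixed⇒∣ {k} x e with k % n in k%n
  ... | zero  = m%n≡0⇒n∣m k n k%n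
  ... | suc r = ⊥-elim (no-shorter-period x z<s (subst (_< n) k%n (m%n<n k n))
                  (trans (cong (λ t → iter σ t x) (sym k%n)) (trans (sym (iter-% σ (period x) k)) e)))

  ∣⇒iter-fixed : ∀ {k} x → n ∣ k → iter σ k x ≡ x
  ∣⇒iter-fixed x (divides q refl) = iter-* σ (period x) q

module _ {n : ℕ} .{{_ : NonZero n}} {σ τ : Permutation′ n}
         (σ-cycle : IsNCycle σ) (τ-cycle : IsNCycle τ) where

  iter-≡-transfer-≤ : ∀ {p q} x y → p ≤ q → iter σ q x ≡ iter σ p x → iter τ q y ≡ iter τ p y
  iter-≡-transfer-≤ {p} {q} x y p≤q e = trans (iter-∸ τ y p≤q) (∣⇒iter-fixed τ-cycle {q ∸ p} (iter τ p y)
    (iter-fixed⇒∣ σ-cycle (iter σ p x) (trans (sym (iter-∸ σ x p≤q)) e)))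

  -- In an n-cycle σᵃ x ≡ σᵇ x holds exactly when n divides b − a, independently of x and σ.
  iter-≡-transfer : ∀ {a b} x y → iter σ a x ≡ iter σ b x → iter τ a y ≡ iter τ b y
  iter-≡-transfer {a} {b} x y e with ≤-total a b
  ... | inj₁ a≤b = sym (iter-≡-transfer-≤ x y a≤b (sym e))
  ... | inj₂ b≤a = iter-≡-transfer-≤ x y b≤a e

-- Subtypes with irrelevant proofs

Σᴵ : (X : Set) → (X → Set) → Set
Σᴵ X P = Σ X (Irrelevant ∘ P)

Σᴵ-≡ : ∀ {X : Set} {P : X → Set} {x y : X} {p : Irrelevant (P x)} {q : Irrelevant (P y)} → x ≡ y →
       _≡_ {A = Σᴵ X P} (x , p) (y , q)
Σᴵ-≡ refl = refl

module _ {X Y : Set} {P : X → Set} {Q : Y → Set} where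

  Σᴵ-cong : (e : X ↔ Y) → (∀ {x} → P x → Q (Inverse.to e x)) → (∀ {y} → Q y → P (Inverse.from e y)) →
            Σᴵ X P ↔ Σᴵ Y Q
  Σᴵ-cong e P⇒Q Q⇒P = mk↔ₛ′
    (λ { (x , [ p ]) → Inverse.to e x , [ P⇒Q p ] })
    (λ { (y , [ q ]) → Inverse.from e y , [ Q⇒P q ] })
    (λ { (y , _) → Σᴵ-≡ (Inverse.strictlyInverseˡ e y) })
    (λ { (x , _) → Σᴵ-≡ (Inverse.strictlyInverseʳ e x) })

-- The round trip g (f x) ≡ x is only known from an irrelevant P x; deciding it makes it relevant.
Σᴵ-retract : ∀ {X Y : Set} {P : X → Set} → DecidableEquality X → (f : X → Y) (g : Y → X) →
             (∀ y → f (g y) ≡ y) → (∀ {x} → P x → g (f x) ≡ x) → Σᴵ X P ↔ Σᴵ Y (P ∘ g)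
Σᴵ-retract {P = P} _≟ˣ_ f g fg gf = mk↔ₛ′
  (λ { (x , [ p ]) → f x , [ subst P (sym (gf p)) p ] })
  (λ { (y , [ p ]) → g y , [ p ] })
  (λ { (y , _) → Σᴵ-≡ (fg y) })
  (λ { (x , [ p ]) → Σᴵ-≡ (recompute (g (f x) ≟ˣ x) (gf p)) })

Σᴵ-assoc : ∀ {X : Set} {P Q : X → Set} → Σᴵ X (λ x → P x × Q x) ↔ Σᴵ (Σᴵ X P) (Q ∘ proj₁)
Σᴵ-assoc = mk↔ₛ′
  (λ { (x , [ pq ]) → (x , [ proj₁ pq ]) , [ proj₂ pq ] })
  (λ { ((x , [ p ]) , [ q ]) → x , [ p , q ] })
  (λ _ → refl) (λ _ → refl)

Σᴵ-all : ∀ {X : Set} {P : X → Set} → (∀ x → P x) → Σᴵ X P ↔ X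
Σᴵ-all all = mk↔ₛ′ proj₁ (λ x → x , [ all x ]) (λ _ → refl) (λ _ → Σᴵ-≡ refl)

Σᴵ-fibres : ∀ {X Y Z F : Set} {P : Z → X → Y → Set} → (∀ z y → Σᴵ X (λ x → P z x y) ↔ F) →
            Σᴵ (Z × X × Y) (λ (z , x , y) → P z x y) ↔ (Z × Y × F)
Σᴵ-fibres {P = P} fibre = mk↔ₛ′
  (λ { ((z , x , y) , p) → z , y , Inverse.to (fibre z y) (x , p) })
  (λ { (z , y , f) → let (x , p) = Inverse.from (fibre z y) f in (z , x , y) , p })
  (λ { (z , y , f) → cong (λ f′ → z , y , f′) (Inverse.strictlyInverseˡ (fibre z y) f) })
  (λ { ((z , x , y) , p) →
        Σᴵ-≡ (cong (λ w → z , proj₁ w , y) (Inverse.strictlyInverseʳ (fibre z y) (x , p))) })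

Fin-≡↔ : ∀ {a b} → a ≡ b → Fin a ↔ Fin b
Fin-≡↔ refl = ↔-refl

Fin-remove-one↔ : ∀ {m} (a : Fin (suc m)) → Σᴵ (Fin (suc m)) (_≢ a) ↔ Fin m
Fin-remove-one↔ a = mk↔ₛ′
  (λ { (x , [ x≢a ]) → punchOut (¬-recompute (x≢a ∘ sym)) })
  (λ y → punchIn a y , [ punchInᵢ≢i a y ])
  (λ y → trans (punchOut-cong a refl) (punchOut-punchIn a))
  (λ { (x , _) → Σᴵ-≡ (punchIn-punchOut _) })

Fin-remove-two↔ : ∀ {n} (a b : Fin n) → a ≢ b → Σᴵ (Fin n) (λ x → x ≢ a × x ≢ b) ↔ Fin (n ∸ 2)
Fin-remove-two↔ {suc zero}    zero zero a≢b = ⊥-elim (a≢b refl)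
Fin-remove-two↔ {suc (suc m)} a    b    a≢b =
  ↔-trans Σᴵ-assoc (↔-trans removing-a (Fin-remove-one↔ b′))
  where
  b′ : Fin (suc m)
  b′ = punchOut a≢b
  removing-a : Σᴵ (Σᴵ (Fin (suc (suc m))) (_≢ a)) (λ x → proj₁ x ≢ b) ↔ Σᴵ (Fin (suc m)) (_≢ b′)
  removing-a = Σᴵ-cong (Fin-remove-one↔ a)
    (λ x≢b e → x≢b (punchOut-injective _ a≢b e))
    (λ y≢b′ e → y≢b′ (sym (trans (punchOut-cong a (sym e)) (punchOut-punchIn a))))

Pairs : ℕ → Set
Pairs m = Σᴵ (Fin m × Fin m) (uncurry _<ᶠ_)

first second : ∀ {m} → Pairs m → Fin m
first  ((i , _) , _) = i
second ((_ , j) , _) = j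

shift : ∀ {m} → Pairs m → Pairs (suc m)
shift ((i , j) , i<j) = (suc i , suc j) , Irr.map s<s i<j

Pairs-suc↔ : ∀ {m} → Pairs (suc m) ↔ (Fin m ⊎ Pairs m)
Pairs-suc↔ {m} = mk↔ₛ′ split (λ { (inj₁ j) → (zero , suc j) , [ z<s ] ; (inj₂ t) → shift t })
  (λ { (inj₁ j) → refl ; (inj₂ _) → refl })
  (λ { ((zero , suc _) , _) → refl ; ((suc _ , suc _) , _) → refl })
  where
  split : Pairs (suc m) → Fin m ⊎ Pairs m
  split ((zero  , zero)  , [ () ])
  split ((zero  , suc j) , _)       = inj₁ j
  split ((suc i , zero)  , [ () ])
  split ((suc i , suc j) , i<j)     = inj₂ ((i , j) , Irr.map s<s⁻¹ i<j)

[1+m]C2≡m+mC2 : ∀ m → suc m C 2 ≡ m + m C 2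
[1+m]C2≡m+mC2 m = trans (sym (nCk+nC[k+1]≡[n+1]C[k+1] m 1)) (cong (_+ m C 2) (nC1≡n m))

Pairs↔ : ∀ m → Pairs m ↔ Fin (m C 2)
Pairs↔ zero    = mk↔ₛ′ (λ { ((() , _) , _) }) (λ ()) (λ ()) (λ { ((() , _) , _) })
Pairs↔ (suc m) = ↔-trans Pairs-suc↔
  (↔-trans (↔-refl ⊎-↔ Pairs↔ m) (↔-trans (↔-sym +↔⊎) (Fin-≡↔ (sym ([1+m]C2≡m+mC2 m)))))

[1+m]C2*2≡[1+m]*m : ∀ m → (suc m C 2) * 2 ≡ suc m * m
[1+m]C2*2≡[1+m]*m zero    = refl
[1+m]C2*2≡[1+m]*m (suc m) = begin
  (suc (suc m) C 2) * 2        ≡⟨ cong (_* 2) ([1+m]C2≡m+mC2 (suc m)) ⟩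
  (suc m + suc m C 2) * 2      ≡⟨ *-distribʳ-+ 2 (suc m) (suc m C 2) ⟩
  suc m * 2 + (suc m C 2) * 2  ≡⟨ cong (suc m * 2 +_) ([1+m]C2*2≡[1+m]*m m) ⟩
  suc m * 2 + suc m * m        ≡⟨ regroup m ⟩
  suc (suc m) * suc m          ∎
  where
  open ≡-Reasoning
  regroup : ∀ m → suc m * 2 + suc m * m ≡ suc (suc m) * suc m
  regroup = solve-∀

n²[n∸1][n∸2]/2≡nC2*n[n∸2] : ∀ n → (n ^ 2 * (n ∸ 1) * (n ∸ 2)) / 2 ≡ (n C 2) * (n * (n ∸ 2))
n²[n∸1][n∸2]/2≡nC2*n[n∸2] zero    = refl
n²[n∸1][n∸2]/2≡nC2*n[n∸2] (suc m) =
  trans (cong (_/ 2) doubled) (m*n/n≡m ((suc m C 2) * (suc m * (m ∸ 1))) 2)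
  where
  open ≡-Reasoning
  n = suc m
  doubled : n ^ 2 * m * (m ∸ 1) ≡ (n C 2) * (n * (m ∸ 1)) * 2
  doubled = begin
    n ^ 2 * m * (m ∸ 1)          ≡⟨ regroup₁ n m (m ∸ 1) ⟩
    n * m * (n * (m ∸ 1))        ≡⟨ cong (_* (n * (m ∸ 1))) ([1+m]C2*2≡[1+m]*m m) ⟨
    (n C 2) * 2 * (n * (m ∸ 1))  ≡⟨ regroup₂ (n C 2) (n * (m ∸ 1)) ⟩
    (n C 2) * (n * (m ∸ 1)) * 2  ∎
    where
    regroup₁ : ∀ n m z → n * (n * 1) * m * z ≡ n * m * (n * z)
    regroup₁ = solve-∀
    regroup₂ : ∀ c w → c * 2 * w ≡ c * w * 2
    regroup₂ = solve-∀

-- Rows with one or two filled cells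

Row : ℕ → ℕ → Set
Row a m = Vec (Maybe (Fin a)) m

module _ {a : ℕ} where

  empty : ∀ {m} → Row a m
  empty = replicate _ nothing

  single : ∀ {m} → Fin m → Fin a → Row a m
  single i x = empty [ i ]≔ just x

  pair : ∀ {m} → Pairs m → Fin a → Fin a → Row a m
  pair ((i , j) , _) x y = single i x [ j ]≔ just y

  rowSize-empty : ∀ m → rowSize (empty {m}) ≡ 0
  rowSize-empty zero    = refl
  rowSize-empty (suc m) = rowSize-empty m

  rowSize≡0⇒empty : ∀ {m} (v : Row a m) → rowSize v ≡ 0 → v ≡ empty
  rowSize≡0⇒empty []            _ = refl
  rowSize≡0⇒empty (nothing ∷ v) p = cong (nothing ∷_) (rowSize≡0⇒empty v p)

  rowSize-fill : ∀ {m} (v : Row a m) i x → lookup v i ≡ nothing → rowSize (v [ i ]≔ just x) ≡ suc (rowSize v)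
  rowSize-fill (nothing ∷ v) zero    x _ = refl
  rowSize-fill (just y  ∷ v) (suc i) x e = cong suc (rowSize-fill v i x e)
  rowSize-fill (nothing ∷ v) (suc i) x e = rowSize-fill v i x e

  rowSize-single : ∀ {m} (i : Fin m) x → rowSize (single i x) ≡ 1
  rowSize-single {m} i x = trans (rowSize-fill empty i x (lookup-replicate i nothing)) (cong suc (rowSize-empty m))

  lookup-single-≢ : ∀ {m} {i j : Fin m} x → j ≢ i → lookup (single i x) j ≡ nothing
  lookup-single-≢ {j = j} x j≢i = trans (lookup∘update′ j≢i empty (just x)) (lookup-replicate j nothing)

  lookup-single : ∀ {m} (i : Fin m) x j {z} → lookup (single i x) j ≡ just z → j ≡ i × z ≡ x
  lookup-single i x j e with j ≟ i
  ... | yes refl = refl , just-injective (trans (sym e) (lookup∘update i empty (just x)))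
  ... | no j≢i   with () ← trans (sym e) (lookup-single-≢ x j≢i)

  rowSize-pair : ∀ {m} (t : Pairs m) x y → rowSize (pair t x y) ≡ 2
  rowSize-pair ((i , j) , [ i<j ]) x y =
    trans (rowSize-fill (single i x) j y (lookup-single-≢ x (¬-recompute (<⇒≢ i<j ∘ sym))))
          (cong suc (rowSize-single i x))

  lookup-pair-first : ∀ {m} (t : Pairs m) x y → lookup (pair t x y) (first t) ≡ just x
  lookup-pair-first ((i , j) , [ i<j ]) x y =
    trans (lookup∘update′ (¬-recompute (<⇒≢ i<j)) (single i x) (just y)) (lookup∘update i empty (just x))

  lookup-pair-second : ∀ {m} (t : Pairs m) x y → lookup (pair t x y) (second t) ≡ just y
  lookup-pair-second ((i , j) , _) x y = lookup∘update j (single i x) (just y)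

  lookup-pair : ∀ {m} (t : Pairs m) x y k {z} → lookup (pair t x y) k ≡ just z →
                (k ≡ first t × z ≡ x) ⊎ (k ≡ second t × z ≡ y)
  lookup-pair ((i , j) , _) x y k e with k ≟ j
  ... | yes refl = inj₂ (refl , just-injective (trans (sym e) (lookup∘update j (single i x) (just y))))
  ... | no k≢j   = inj₁ (lookup-single i x k (trans (sym (lookup∘update′ k≢j (single i x) (just y))) e))

  filled₁ : ∀ {m} (v : Row a m) → rowSize v ≡ 1 → Fin m × Fin a
  filled₁ (just x  ∷ v) _ = zero , x
  filled₁ (nothing ∷ v) p = let (i , x) = filled₁ v p in suc i , x

  filled₁-single : ∀ {m} (i : Fin m) x p → filled₁ (single i x) p ≡ (i , x)
  filled₁-single zero    x p = refl
  filled₁-single (suc i) x p = cong (λ (i′ , x′) → suc i′ , x′) (filled₁-single i x p)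

  single-filled₁ : ∀ {m} (v : Row a m) p → uncurry single (filled₁ v p) ≡ v
  single-filled₁ (just x  ∷ v) p = cong (just x ∷_) (sym (rowSize≡0⇒empty v (suc-injective p)))
  single-filled₁ (nothing ∷ v) p = cong (nothing ∷_) (single-filled₁ v p)

  Row₁↔ : ∀ {m} → Σᴵ (Row a m) (λ v → rowSize v ≡ 1) ↔ (Fin m × Fin a)
  Row₁↔ = mk↔ₛ′ (λ { (v , [ p ]) → filled₁ v (recompute (rowSize v ℕ.≟ 1) p) })
    (λ (i , x) → single i x , [ rowSize-single i x ])
    (λ (i , x) → filled₁-single i x _)
    (λ { (v , _) → Σᴵ-≡ (single-filled₁ v _) })

  filled₂ : ∀ {m} (v : Row a m) → rowSize v ≡ 2 → Pairs m × Fin a × Fin a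
  filled₂ (just x  ∷ v) p = let (j , y) = filled₁ v (suc-injective p) in ((zero , suc j) , [ z<s ]) , x , y
  filled₂ (nothing ∷ v) p = let (t , x , y) = filled₂ v p in shift t , x , y

  filled₂-pair : ∀ {m} (t : Pairs m) x y p → filled₂ (pair t x y) p ≡ (t , x , y)
  filled₂-pair ((zero  , zero)  , [ () ]) x y p
  filled₂-pair ((zero  , suc j) , _)      x y p =
    cong (λ (j′ , y′) → ((zero , suc j′) , [ z<s ]) , x , y′) (filled₁-single j y (suc-injective p))
  filled₂-pair ((suc i , zero)  , [ () ]) x y p
  filled₂-pair ((suc i , suc j) , i<j)    x y p =
    cong (λ (t , x′ , y′) → shift t , x′ , y′) (filled₂-pair ((i , j) , Irr.map s<s⁻¹ i<j) x y p)

  pair-filled₂ : ∀ {m} (v : Row a m) p → let (t , x , y) = filled₂ v p in pair t x y ≡ v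
  pair-filled₂ (just x  ∷ v) p = cong (just x ∷_) (single-filled₁ v (suc-injective p))
  pair-filled₂ (nothing ∷ v) p = cong (nothing ∷_) (pair-filled₂ v p)

  Row₂↔ : ∀ {m} → Σᴵ (Row a m) (λ v → rowSize v ≡ 2) ↔ (Pairs m × Fin a × Fin a)
  Row₂↔ = mk↔ₛ′ (λ { (v , [ p ]) → filled₂ v (recompute (rowSize v ℕ.≟ 2) p) })
    (λ (t , x , y) → pair t x y , [ rowSize-pair t x y ])
    (λ (t , x , y) → filled₂-pair t x y _)
    (λ { (v , _) → Σᴵ-≡ (pair-filled₂ v _) })

Vec-ext : ∀ {A : Set} {m} {u v : Vec A m} → (∀ i → lookup u i ≡ lookup v i) → u ≡ v
Vec-ext {u = u} {v} e = trans (sym (tabulate∘lookup u)) (trans (tabulate-cong e) (tabulate∘lookup v))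

Array-ext : ∀ {n} {P Q : Array n} → (∀ r c → entry P r c ≡ entry Q r c) → P ≡ Q
Array-ext e = Vec-ext (λ r → Vec-ext (e r))

entry-tabulate : ∀ {n} (f : Fin n → Fin n → Maybe (Fin n)) r c → entry (tabulate (tabulate ∘ f)) r c ≡ f r c
entry-tabulate f r c = trans (cong (λ v → lookup v c) (lookup∘tabulate _ r)) (lookup∘tabulate _ c)

filled : ∀ {A : Set} → Maybe A → ℕ
filled (just _) = 1
filled nothing  = 0

rowSize-sum : ∀ {a m} (v : Row a m) → rowSize v ≡ sum (filled ∘ lookup v)
rowSize-sum []            = refl
rowSize-sum (just _  ∷ v) = cong suc (rowSize-sum v)
rowSize-sum (nothing ∷ v) = rowSize-sum v

rowSize-relabel : ∀ {a b m} (f : Fin a → Fin b) (π : Permutation′ m) (v : Row a m) →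
                  rowSize (tabulate (λ c → Maybe.map f (lookup v (π ⟨$⟩ʳ c)))) ≡ rowSize v
rowSize-relabel f π v = begin
  rowSize (tabulate relabelled)                ≡⟨ rowSize-sum (tabulate relabelled) ⟩
  sum (filled ∘ lookup (tabulate relabelled))  ≡⟨ sum-cong-≗ (cong filled ∘ lookup∘tabulate relabelled) ⟩
  sum (filled ∘ relabelled)                    ≡⟨ sum-cong-≗ (filled-map ∘ lookup v ∘ (π ⟨$⟩ʳ_)) ⟩
  sum (filled ∘ lookup v ∘ (π ⟨$⟩ʳ_))          ≡⟨ ∑-permute (filled ∘ lookup v) π ⟨
  sum (filled ∘ lookup v)                      ≡⟨ rowSize-sum v ⟨
  rowSize v                                    ∎
  where
  open ≡-Reasoning
  relabelled : Fin _ → Maybe (Fin _)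
  relabelled c = Maybe.map f (lookup v (π ⟨$⟩ʳ c))
  filled-map : ∀ x → filled (Maybe.map f x) ≡ filled x
  filled-map (just _) = refl
  filled-map nothing  = refl

sizeRows-uniform : ∀ {k n s} (P : Vec (Vec (Maybe (Fin n)) n) k) →
                   (∀ r → rowSize (lookup P r) ≡ s) → sizeRows P ≡ k * s
sizeRows-uniform []      _ = refl
sizeRows-uniform (v ∷ P) e = cong₂ _+_ (e zero) (sizeRows-uniform P (e ∘ suc))

map-≡-just : ∀ {A B : Set} {f : A → B} (m : Maybe A) {y} →
             Maybe.map f m ≡ just y → ∃ λ x → m ≡ just x × f x ≡ y
map-≡-just (just x) refl = x , refl , refl

-- Autotopisms as equivariance

module _ {n : ℕ} (α β γ : Permutation′ n) where

  Equivariant : Array n → Set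
  Equivariant P = ∀ r c → entry P (α ⟨$⟩ʳ r) (β ⟨$⟩ʳ c) ≡ Maybe.map (γ ⟨$⟩ʳ_) (entry P r c)

  autotopism⇒equivariant : ∀ {P} → IsAutotopism (α , β , γ) P → Equivariant P
  autotopism⇒equivariant {P} (forth , back) r c with entry P r c in e
  ... | just s  = forth r c s e
  ... | nothing with entry P (α ⟨$⟩ʳ r) (β ⟨$⟩ʳ c) in e′
  ...   | nothing = refl
  ...   | just s′ with back _ _ s′ e′
  ...     | r₁ , c₁ , s₁ , e₁ , αr₁≡αr , βc₁≡βc , _
          with () ← trans (sym e) (subst₂ (λ r′ c′ → entry P r′ c′ ≡ just s₁)
                     (⟨$⟩ʳ-injective α αr₁≡αr) (⟨$⟩ʳ-injective β βc₁≡βc) e₁)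

  equivariant⇒autotopism : ∀ {P} → Equivariant P → IsAutotopism (α , β , γ) P
  equivariant⇒autotopism {P} eq = forth , back
    where
    forth : ∀ r c s → (r , c , s) ∈O P → (α ⟨$⟩ʳ r , β ⟨$⟩ʳ c , γ ⟨$⟩ʳ s) ∈O P
    forth r c s e = trans (eq r c) (cong (Maybe.map (γ ⟨$⟩ʳ_)) e)
    back : ∀ r′ c′ s′ → (r′ , c′ , s′) ∈O P →
           Σ (Fin n) λ r → Σ (Fin n) λ c → Σ (Fin n) λ s →
             (r , c , s) ∈O P × α ⟨$⟩ʳ r ≡ r′ × β ⟨$⟩ʳ c ≡ c′ × γ ⟨$⟩ʳ s ≡ s′
    back r′ c′ s′ e
      with s , e₁ , γs≡s′ ← map-≡-just (entry P (α ⟨$⟩ˡ r′) (β ⟨$⟩ˡ c′))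
             (trans (sym (eq _ _)) (subst₂ (λ r c → entry P r c ≡ just s′) (sym (inverseʳ α)) (sym (inverseʳ β)) e))
      = α ⟨$⟩ˡ r′ , β ⟨$⟩ˡ c′ , s , e₁ , inverseʳ α , inverseʳ β , γs≡s′

  equivariant-iter : ∀ {P} → Equivariant P → ∀ k r c →
                     entry P (iter α k r) (iter β k c) ≡ Maybe.map (iter γ k) (entry P r c)
  equivariant-iter {P} eq zero    r c = sym (map-id (entry P r c))
  equivariant-iter {P} eq (suc k) r c = begin
    entry P (α ⟨$⟩ʳ iter α k r) (β ⟨$⟩ʳ iter β k c)
      ≡⟨ eq _ _ ⟩
    Maybe.map (γ ⟨$⟩ʳ_) (entry P (iter α k r) (iter β k c))
      ≡⟨ cong (Maybe.map (γ ⟨$⟩ʳ_)) (equivariant-iter {P} eq k r c) ⟩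
    Maybe.map (γ ⟨$⟩ʳ_) (Maybe.map (iter γ k) (entry P r c))
      ≡⟨ map-∘ (entry P r c) ⟨
    Maybe.map (iter γ (suc k)) (entry P r c)
      ∎
    where open ≡-Reasoning

-- Arrays with an autotopism of three n-cycles

module _ {m : ℕ} (α β γ : Permutation′ (suc m))
         (α-cycle : IsNCycle α) (β-cycle : IsNCycle β) (γ-cycle : IsNCycle γ) where

  private
    n : ℕ
    n = suc m

  r₀ : Fin n
  r₀ = zero

  log : Fin n → ℕ
  log r = proj₁ (α-cycle r₀ r)

  column : Fin n → Fin n → Fin n
  column r c = power β (log r) ⟨$⟩ˡ c

  orbit-coordinates : ∀ r c → ∃₂ λ k c′ → iter α k r₀ ≡ r × iter β k c′ ≡ c
  orbit-coordinates r c = log r , column r c , proj₂ (α-cycle r₀ r) , iter-power⁻¹ β (log r) c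

  cell : Row n n → Fin n → Fin n → Maybe (Fin n)
  cell g r c = Maybe.map (iter γ (log r)) (lookup g (column r c))

  fromRow : Row n n → Array n
  fromRow g = tabulate (tabulate ∘ cell g)

  firstRow : Array n → Row n n
  firstRow P = lookup P r₀

  entry-fromRow : ∀ g k c → entry (fromRow g) (iter α k r₀) (iter β k c) ≡ Maybe.map (iter γ k) (lookup g c)
  entry-fromRow g k c = begin
    entry (fromRow g) r (iter β k c)
      ≡⟨ entry-tabulate (cell g) r (iter β k c) ⟩
    Maybe.map (iter γ L) (lookup g (column r (iter β k c)))
      ≡⟨ cong (λ c′ → Maybe.map (iter γ L) (lookup g (column r c′))) βᵏc≡βᴸc ⟩
    Maybe.map (iter γ L) (lookup g (column r (iter β L c)))
      ≡⟨ cong (Maybe.map (iter γ L) ∘ lookup g) (power⁻¹-iter β L c) ⟩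
    Maybe.map (iter γ L) (lookup g c)
      ≡⟨ map-cong γᴸ≗γᵏ (lookup g c) ⟩
    Maybe.map (iter γ k) (lookup g c)
      ∎
    where
    open ≡-Reasoning
    r = iter α k r₀
    L = log r
    αᴸ≡αᵏ : iter α L r₀ ≡ iter α k r₀
    αᴸ≡αᵏ = proj₂ (α-cycle r₀ r)
    βᵏc≡βᴸc : iter β k c ≡ iter β L c
    βᵏc≡βᴸc = iter-≡-transfer α-cycle β-cycle {k} {L} r₀ c (sym αᴸ≡αᵏ)
    γᴸ≗γᵏ : ∀ x → iter γ L x ≡ iter γ k x
    γᴸ≗γᵏ x = iter-≡-transfer α-cycle γ-cycle {L} {k} r₀ x αᴸ≡αᵏ

  entry-fromRow-r₀ : ∀ g c → entry (fromRow g) r₀ c ≡ lookup g c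
  entry-fromRow-r₀ g c = trans (entry-fromRow g 0 c) (map-id (lookup g c))

  firstRow-fromRow : ∀ g → firstRow (fromRow g) ≡ g
  firstRow-fromRow g = Vec-ext (entry-fromRow-r₀ g)

  fromRow-firstRow : ∀ P → Equivariant α β γ P → fromRow (firstRow P) ≡ P
  fromRow-firstRow P eq = Array-ext pointwise
    where
    pointwise : ∀ r c → entry (fromRow (firstRow P)) r c ≡ entry P r c
    pointwise r c with k , c′ , refl , refl ← orbit-coordinates r c
      = trans (entry-fromRow (firstRow P) k c′) (sym (equivariant-iter α β γ {P} eq k r₀ c′))

  fromRow-equivariant : ∀ g → Equivariant α β γ (fromRow g)
  fromRow-equivariant g r c with k , c′ , refl , refl ← orbit-coordinates r c = begin
    entry (fromRow g) (iter α (suc k) r₀) (iter β (suc k) c′)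
      ≡⟨ entry-fromRow g (suc k) c′ ⟩
    Maybe.map (iter γ (suc k)) (lookup g c′)
      ≡⟨ map-∘ (lookup g c′) ⟩
    Maybe.map (γ ⟨$⟩ʳ_) (Maybe.map (iter γ k) (lookup g c′))
      ≡⟨ cong (Maybe.map (γ ⟨$⟩ʳ_)) (entry-fromRow g k c′) ⟨
    Maybe.map (γ ⟨$⟩ʳ_) (entry (fromRow g) (iter α k r₀) (iter β k c′))
      ∎
    where open ≡-Reasoning

  size-fromRow : ∀ g → size (fromRow g) ≡ n * rowSize g
  size-fromRow g = sizeRows-uniform {s = rowSize g} (fromRow g) λ r →
    trans (cong rowSize (lookup∘tabulate (tabulate ∘ cell g) r))
          (rowSize-relabel (iter γ (log r)) (flip (power β (log r))) g)

  RowInjective : Row n n → Set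
  RowInjective g = ∀ {i j x} → lookup g i ≡ just x → lookup g j ≡ just x → i ≡ j

  -- The filled cells of fromRow g are (αᵏ r₀, βᵏ i, γᵏ x) for g i = x: two of them sharing
  -- column and symbol share their row.
  ColumnCondition : Row n n → Set
  ColumnCondition g = ∀ {i j x y} k l → lookup g i ≡ just x → lookup g j ≡ just y →
    iter β k i ≡ iter β l j → iter γ k x ≡ iter γ l y → iter α k r₀ ≡ iter α l r₀

  ∈O-fromRow : ∀ g {r c s} → (r , c , s) ∈O fromRow g →
               ∃ λ x → lookup g (column r c) ≡ just x × iter γ (log r) x ≡ s
  ∈O-fromRow g {r} {c} e = map-≡-just (lookup g (column r c)) (trans (sym (entry-tabulate (cell g) r c)) e)

  fromRow-isPLS : ∀ g → RowInjective g → ColumnCondition g → IsPLS (fromRow g)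
  fromRow-isPLS g row-inj col-cond = rows , columns
    where
    rows : ∀ r c c′ s → (r , c , s) ∈O fromRow g → (r , c′ , s) ∈O fromRow g → c ≡ c′
    rows r c c′ s e e′
      with x , gx , γx≡s ← ∈O-fromRow g e | x′ , gx′ , γx′≡s ← ∈O-fromRow g e′
      with refl ← iter-injective γ (log r) (trans γx≡s (sym γx′≡s)) = begin
        c                                   ≡⟨ iter-power⁻¹ β (log r) c ⟨
        iter β (log r) (column r c)         ≡⟨ cong (iter β (log r)) (row-inj gx gx′) ⟩
        iter β (log r) (column r c′)        ≡⟨ iter-power⁻¹ β (log r) c′ ⟩
        c′                                  ∎
      where open ≡-Reasoning
    columns : ∀ r r′ c s → (r , c , s) ∈O fromRow g → (r′ , c , s) ∈O fromRow g → r ≡ r′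
    columns r r′ c s e e′
      with x , gx , γx≡s ← ∈O-fromRow g e | x′ , gx′ , γx′≡s ← ∈O-fromRow g e′ = begin
        r                         ≡⟨ proj₂ (α-cycle r₀ r) ⟨
        iter α (log r) r₀         ≡⟨ col-cond (log r) (log r′) gx gx′
                                       (trans (iter-power⁻¹ β (log r) c) (sym (iter-power⁻¹ β (log r′) c)))
                                       (trans γx≡s (sym γx′≡s)) ⟩
        iter α (log r′) r₀        ≡⟨ proj₂ (α-cycle r₀ r′) ⟩
        r′                        ∎
      where open ≡-Reasoning

  isPLS⇒rowInjective : ∀ g → IsPLS (fromRow g) → RowInjective g
  isPLS⇒rowInjective g (rows , _) {i} {j} {x} gi gj =
    rows r₀ i j x (trans (entry-fromRow-r₀ g i) gi) (trans (entry-fromRow-r₀ g j) gj)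

  isPLS⇒columnCondition : ∀ g → IsPLS (fromRow g) → ColumnCondition g
  isPLS⇒columnCondition g (_ , columns) {i} {j} {x} {y} k l gi gj βi≡βj γx≡γy =
    columns (iter α k r₀) (iter α l r₀) (iter β k i) (iter γ k x)
      (trans (entry-fromRow g k i) (map-just gi))
      (trans (cong (entry (fromRow g) (iter α l r₀)) βi≡βj)
        (trans (entry-fromRow g l j) (trans (map-just gj) (cong just (sym γx≡γy)))))

  single-isPLS : ∀ i x → IsPLS (fromRow (single i x))
  single-isPLS i x = fromRow-isPLS (single i x) row-inj col-cond
    where
    row-inj : RowInjective (single i x)
    row-inj ej ek = trans (proj₁ (lookup-single i x _ ej)) (sym (proj₁ (lookup-single i x _ ek)))
    col-cond : ColumnCondition (single i x)
    col-cond k l ej ek βj≡βk _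
      with refl , _ ← lookup-single i x _ ej | refl , _ ← lookup-single i x _ ek
      = iter-≡-transfer β-cycle α-cycle {k} {l} i r₀ βj≡βk

  offset : Pairs n → ℕ
  offset ((a , b) , _) = proj₁ (β-cycle b a)

  -- With βᵈ b = a, the cell (b, y) of the first row is carried to (αᵈ r₀, a, γᵈ y), in the
  -- column of the cell (a, x); the first condition is the row condition on the first row.
  Admissible : Pairs n × Fin n × Fin n → Set
  Admissible (t , x , y) = x ≢ y × x ≢ iter γ (offset t) y

  offset-nontrivial : ∀ {σ} → IsNCycle σ → ∀ t z → z ≢ iter σ (offset t) z
  offset-nontrivial σ-cycle ((a , b) , [ a<b ]) z z≡σᵈz =
    ¬-recompute (<⇒≢ a<b) (trans (sym (proj₂ (β-cycle b a)))
      (sym (iter-≡-transfer σ-cycle β-cycle {0} {proj₁ (β-cycle b a)} z b z≡σᵈz)))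

  pair-isPLS⇒admissible : ∀ t x y → IsPLS (fromRow (pair t x y)) → Admissible (t , x , y)
  pair-isPLS⇒admissible t@((a , b) , [ a<b ]) x y isPLS = x≢y , x≢γᵈy
    where
    x≢y : x ≢ y
    x≢y refl = ¬-recompute (<⇒≢ a<b)
      (isPLS⇒rowInjective (pair t x y) isPLS (lookup-pair-first t x y) (lookup-pair-second t x y))
    x≢γᵈy : x ≢ iter γ (offset t) y
    x≢γᵈy x≡γᵈy = offset-nontrivial {α} α-cycle t r₀
      (isPLS⇒columnCondition (pair t x y) isPLS 0 (offset t) (lookup-pair-first t x y) (lookup-pair-second t x y)
        (sym (proj₂ (β-cycle b a))) x≡γᵈy)

  admissible⇒pair-isPLS : ∀ t x y → Admissible (t , x , y) → IsPLS (fromRow (pair t x y))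
  admissible⇒pair-isPLS t@((a , b) , _) x y (x≢y , x≢γᵈy) = fromRow-isPLS (pair t x y) row-inj col-cond
    where
    d = offset t
    row-inj : RowInjective (pair t x y)
    row-inj {i} {j} ei ej with lookup-pair t x y i ei | lookup-pair t x y j ej
    ... | inj₁ (refl , _)     | inj₁ (refl , _)     = refl
    ... | inj₂ (refl , _)     | inj₂ (refl , _)     = refl
    ... | inj₁ (_ , refl)     | inj₂ (_ , z≡y)      = ⊥-elim (x≢y z≡y)
    ... | inj₂ (_ , refl)     | inj₁ (_ , z≡x)      = ⊥-elim (x≢y (sym z≡x))
    different-rows : ∀ k l → iter β k a ≡ iter β l b → iter γ k x ≡ iter γ l y → ⊥
    different-rows k l βᵏa≡βˡb γᵏx≡γˡy = x≢γᵈy (iter-injective γ k (begin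
      iter γ k x              ≡⟨ γᵏx≡γˡy ⟩
      iter γ l y              ≡⟨ iter-≡-transfer β-cycle γ-cycle {l} {k + d} b y βˡb≡βᵏ⁺ᵈb ⟩
      iter γ (k + d) y        ≡⟨ iter-+ γ k d y ⟩
      iter γ k (iter γ d y)   ∎))
      where
      open ≡-Reasoning
      βˡb≡βᵏ⁺ᵈb : iter β l b ≡ iter β (k + d) b
      βˡb≡βᵏ⁺ᵈb = begin
        iter β l b              ≡⟨ βᵏa≡βˡb ⟨
        iter β k a              ≡⟨ cong (iter β k) (proj₂ (β-cycle b a)) ⟨
        iter β k (iter β d b)   ≡⟨ iter-+ β k d b ⟨
        iter β (k + d) b        ∎
    col-cond : ColumnCondition (pair t x y)
    col-cond {i} {j} k l ei ej βi≡βj γx≡γy with lookup-pair t x y i ei | lookup-pair t x y j ej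
    ... | inj₁ (refl , _)    | inj₁ (refl , _)    = iter-≡-transfer β-cycle α-cycle {k} {l} a r₀ βi≡βj
    ... | inj₂ (refl , _)    | inj₂ (refl , _)    = iter-≡-transfer β-cycle α-cycle {k} {l} b r₀ βi≡βj
    ... | inj₁ (refl , refl) | inj₂ (refl , refl) = ⊥-elim (different-rows k l βi≡βj γx≡γy)
    ... | inj₂ (refl , refl) | inj₁ (refl , refl) = ⊥-elim (different-rows l k (sym βi≡βj) (sym γx≡γy))

  PLS↔rows : ∀ N k → N ≡ n * k → PLSWithAutotopism n N (α , β , γ) ↔
             Σᴵ (Σᴵ (Row n n) (λ g → rowSize g ≡ k)) (IsPLS ∘ fromRow ∘ proj₁)
  PLS↔rows N k N≡nk =
    ↔-trans (Σᴵ-retract {P = Counted} Array-≟ firstRow fromRow firstRow-fromRow determined-by-firstRow)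
            (↔-trans (Σᴵ-cong {P = Counted ∘ fromRow} {Q = Q} ↔-refl (λ {g} → forth {g}) (λ {g} → back {g}))
                     Σᴵ-assoc)
    where
    Counted : Array n → Set
    Counted P = IsPLS P × size P ≡ N × IsAutotopism (α , β , γ) P
    Q : Row n n → Set
    Q g = rowSize g ≡ k × IsPLS (fromRow g)
    Array-≟ : DecidableEquality (Array n)
    Array-≟ = Vecₚ.≡-dec (Vecₚ.≡-dec (Maybeₚ.≡-dec _≟_))
    determined-by-firstRow : ∀ {P} → Counted P → fromRow (firstRow P) ≡ P
    determined-by-firstRow {P} (_ , _ , aut) = fromRow-firstRow P (autotopism⇒equivariant α β γ {P} aut)
    forth : ∀ {g} → Counted (fromRow g) → Q g
    forth {g} (isPLS , size≡N , _) =
      *-cancelˡ-≡ (rowSize g) k n (trans (sym (size-fromRow g)) (trans size≡N N≡nk)) , isPLS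
    back : ∀ {g} → Q g → Counted (fromRow g)
    back {g} (rowSize≡k , isPLS) =
      isPLS ,
      trans (size-fromRow g) (trans (cong (n *_) rowSize≡k) (sym N≡nk)) ,
      equivariant⇒autotopism α β γ {fromRow g} (fromRow-equivariant g)

  size-n↔ : PLSWithAutotopism n n (α , β , γ) ↔ (Fin n × Fin n)
  size-n↔ = ↔-trans (PLS↔rows n 1 (sym (*-identityʳ n)))
                    (↔-trans singles (Σᴵ-all (λ (i , x) → single-isPLS i x)))
    where
    singles : Σᴵ (Σᴵ (Row n n) (λ g → rowSize g ≡ 1)) (IsPLS ∘ fromRow ∘ proj₁) ↔
              Σᴵ (Fin n × Fin n) (λ (i , x) → IsPLS (fromRow (single i x)))
    singles = Σᴵ-cong Row₁↔
      (λ {vp} _ → let (i , x) = Inverse.to Row₁↔ vp in single-isPLS i x) (λ isPLS → isPLS)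

  size-2n↔ : PLSWithAutotopism n (2 * n) (α , β , γ) ↔ (Pairs n × Fin n × Fin (n ∸ 2))
  size-2n↔ = ↔-trans (PLS↔rows (2 * n) 2 (*-comm 2 n))
                     (↔-trans pairs (Σᴵ-fibres {P = λ t x y → Admissible (t , x , y)} fibre))
    where
    isPLS⇒admissible : ∀ {vp : Σᴵ (Row n n) (λ v → rowSize v ≡ 2)} →
                       IsPLS (fromRow (proj₁ vp)) → Admissible (Inverse.to Row₂↔ vp)
    isPLS⇒admissible {v , [ p ]} isPLS =
      pair-isPLS⇒admissible t x y (subst (IsPLS ∘ fromRow) (sym (pair-filled₂ v p′)) isPLS)
      where
      p′ = recompute (rowSize v ℕ.≟ 2) p
      t = proj₁ (filled₂ v p′)
      x = proj₁ (proj₂ (filled₂ v p′))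
      y = proj₂ (proj₂ (filled₂ v p′))
    pairs : Σᴵ (Σᴵ (Row n n) (λ g → rowSize g ≡ 2)) (IsPLS ∘ fromRow ∘ proj₁) ↔
            Σᴵ (Pairs n × Fin n × Fin n) Admissible
    pairs = Σᴵ-cong {P = IsPLS ∘ fromRow ∘ proj₁} Row₂↔
      (λ {vp} → isPLS⇒admissible {vp}) (λ {(t , x , y)} → admissible⇒pair-isPLS t x y)
    fibre : ∀ t y → Σᴵ (Fin n) (λ x → Admissible (t , x , y)) ↔ Fin (n ∸ 2)
    fibre t y = Fin-remove-two↔ y (iter γ (offset t) y) (offset-nontrivial {γ} γ-cycle t y)

proposition12 : (n : ℕ) → n ≥ 1 →
    (α β γ : Permutation′ n) → IsNCycle α → IsNCycle β → IsNCycle γ →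
    (Fin (n ^ 2) ↔ PLSWithAutotopism n n (α , β , γ)) ×
    (n > 2 → Fin ((n ^ 2 * (n ∸ 1) * (n ∸ 2)) / 2) ↔ PLSWithAutotopism n (2 * n) (α , β , γ))
proposition12 n@(suc _) _ α β γ α-cycle β-cycle γ-cycle = size-n , λ _ → size-2n
  where
  size-n : Fin (n ^ 2) ↔ PLSWithAutotopism n n (α , β , γ)
  size-n = ↔-trans (Fin-≡↔ (cong (n *_) (*-identityʳ n)))
    (↔-trans *↔× (↔-sym (size-n↔ α β γ α-cycle β-cycle γ-cycle)))
  size-2n : Fin ((n ^ 2 * (n ∸ 1) * (n ∸ 2)) / 2) ↔ PLSWithAutotopism n (2 * n) (α , β , γ)
  size-2n = ↔-trans (Fin-≡↔ (n²[n∸1][n∸2]/2≡nC2*n[n∸2] n))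
    (↔-trans *↔× (↔-trans (↔-sym (Pairs↔ n) ×-↔ *↔×) (↔-sym (size-2n↔ α β γ α-cycle β-cycle γ-cycle))))
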